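{- Let $\mathfrak M_0=\langle S_0,L_0,\mathrm I_0\rangle$ be a partial linear space, $G$ be $\mathbb Z$ or $C_k$ with $k$ even, $k>2$, $\mathfrak M_0\circledast_\circ G=\langle M,\mathcal L,\mathrm I\rangle$, and $i\in G$. Let $\varepsilon_i$ be the map sending $a\in S_0$ to $(i,a)\in M$ if $i$ is even and to $[i,a]\in\mathcal L$ if $i$ is odd, and sending $l\in L_0$ to $[i,l]\in\mathcal L$ if $i$ is even and to $(i,l)\in M$ if $i$ is odd. Then the image of $\mathfrak M_0$ under $\varepsilon_i$ (i.e. the substructure with point set $M_i$ and line set $\mathcal L_i$) is a closed substructure of $\mathfrak M_0\circledast_\circ G$; it is isomorphic to $\mathfrak M_0$ if $i$ is even and to the dual $\mathfrak M_0^\circ$ if $i$ is odd.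
   Context: PLS: incidence structure $\langle S,\mathcal L,\mathrm I\rangle$, $S\cap\mathcal L=\emptyset$, every line on at least two points, every point on at least two lines, two distinct points on at most one common line. The dual $\mathfrak M_0^\circ$ is $\langle L_0,S_0,\mathrm I_0^{ -1}\rangle$. A substructure $\langle B',B''\rangle$ ($B'\subseteq M$, $B''\subseteq\mathcal L$) is closed if (i) any line through two distinct points of $B'$ lies in $B''$, and (ii) any point on two distinct lines of $B''$ lies in $B'$. Dual multiplying $\mathfrak M_0\circledast_\circ G$: point set $\bigcup_{i\in G}M_i$, line set $\bigcup_i\mathcal L_i$, where $M_i=\{i\}\times S_0$, $\mathcal L_i=\{i\}\times L_0$ for even $i$ and $M_i=\{i\}\times L_0$, $\mathcal L_i=\{i\}\times S_0$ for odd $i$; points $(i,a)$, lines $[j,b]$, $(i,a)\,\mathrm I\,[j,b]$ iff either $i=j$ and ($a\,\mathrm I_0\,b$ or $b\,\mathrm I_0\,a$), or $i=j+1$ and $a=b$. -}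

module Defs where

open import Data.Bool using (Bool; true; false; if_then_else_)
open import Data.Nat using (ℕ; zero; suc; _<_)
open import Data.Nat.Divisibility using (_∣_)
open import Data.Nat.DivMod using (_mod_)
open import Data.Integer as ℤ using (ℤ; ∣_∣)
open import Data.Fin using (Fin; toℕ)
open import Data.Product using (Σ; ∃; ∃-syntax; _×_; _,_; proj₁; proj₂)
open import Data.Empty using (⊥)
open import Data.Sum using (_⊎_; inj₁; inj₂)
open import Relation.Binary.PropositionalEquality using (_≡_; _≢_)
open import Function.Bundles using (_↔_; _⇔_; Inverse)

record IncStr : Set₁ where
  constructor incStr
  field
    Pt  : Set
    Ln  : Set
    Inc : Pt → Ln → Set
open IncStr public

record IsPLS (𝔐 : IncStr) : Set where
  field
    line-two-points : ∀ (l : Ln 𝔐) → ∃[ p ] ∃[ q ] (p ≢ q × Inc 𝔐 p l × Inc 𝔐 q l)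
    point-two-lines : ∀ (p : Pt 𝔐) → ∃[ l ] ∃[ m ] (l ≢ m × Inc 𝔐 p l × Inc 𝔐 p m)
    unique-line     : ∀ (p q : Pt 𝔐) (l m : Ln 𝔐) → p ≢ q →
                      Inc 𝔐 p l → Inc 𝔐 q l → Inc 𝔐 p m → Inc 𝔐 q m → l ≡ m

dual : IncStr → IncStr
dual 𝔐 = incStr (Ln 𝔐) (Pt 𝔐) (λ l p → Inc 𝔐 p l)

record _≅_ (𝔄 𝔅 : IncStr) : Set where
  field
    onPt : Pt 𝔄 ↔ Pt 𝔅
    onLn : Ln 𝔄 ↔ Ln 𝔅
    preserves : ∀ (p : Pt 𝔄) (l : Ln 𝔄) →
                Inc 𝔄 p l ⇔ Inc 𝔅 (Inverse.to onPt p) (Inverse.to onLn l)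

IsClosed : (𝔐 : IncStr) → (Pt 𝔐 → Set) → (Ln 𝔐 → Set) → Set
IsClosed 𝔐 B′ B″ =
  (∀ (p q : Pt 𝔐) (l : Ln 𝔐) → p ≢ q → B′ p → B′ q →
     Inc 𝔐 p l → Inc 𝔐 q l → B″ l)
  ×
  (∀ (l m : Ln 𝔐) (p : Pt 𝔐) → l ≢ m → B″ l → B″ m →
     Inc 𝔐 p l → Inc 𝔐 p m → B′ p)

sub : (𝔐 : IncStr) → (Pt 𝔐 → Set) → (Ln 𝔐 → Set) → IncStr
sub 𝔐 B′ B″ = incStr (Σ (Pt 𝔐) B′) (Σ (Ln 𝔐) B″)
                     (λ p l → Inc 𝔐 (proj₁ p) (proj₁ l))

isEvenℕ : ℕ → Bool
isEvenℕ zero          = true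
isEvenℕ (suc zero)    = false
isEvenℕ (suc (suc n)) = isEvenℕ n

data IdxGroup : Set where
  ℤ-group : IdxGroup
  C       : (k : ℕ) → 2 ∣ k → 2 < k → IdxGroup

Carrier : IdxGroup → Set
Carrier ℤ-group   = ℤ
Carrier (C k _ _) = Fin k

sucG : (G : IdxGroup) → Carrier G → Carrier G
sucG ℤ-group i = i ℤ.+ ℤ.1ℤ
sucG (C (suc k) _ _) i = suc (toℕ i) mod (suc k)

-- parity of an element of G (well defined on C_k since k is even)
isEvenG : (G : IdxGroup) → Carrier G → Bool
isEvenG ℤ-group   i = isEvenℕ ∣ i ∣
isEvenG (C k _ _) i = isEvenℕ (toℕ i)

module _ (𝔐₀ : IncStr) (G : IdxGroup) where
  private
    S₀ = Pt 𝔐₀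
    L₀ = Ln 𝔐₀

  -- second coordinate of points of M_i / lines of 𝓛_i
  PtComp : Carrier G → Set
  PtComp i = if isEvenG G i then S₀ else L₀

  LnComp : Carrier G → Set
  LnComp i = if isEvenG G i then L₀ else S₀

  embPt : (i : Carrier G) → PtComp i → S₀ ⊎ L₀
  embPt i with isEvenG G i
  ... | true  = inj₁
  ... | false = inj₂

  embLn : (i : Carrier G) → LnComp i → S₀ ⊎ L₀
  embLn i with isEvenG G i
  ... | true  = inj₂
  ... | false = inj₁

  SymInc : S₀ ⊎ L₀ → S₀ ⊎ L₀ → Set
  SymInc (inj₁ a) (inj₂ l) = Inc 𝔐₀ a l
  SymInc (inj₂ l) (inj₁ a) = Inc 𝔐₀ a l
  SymInc _        _        = ⊥

  DMPt : Set
  DMPt = Σ (Carrier G) PtComp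

  DMLn : Set
  DMLn = Σ (Carrier G) LnComp

  DMInc : DMPt → DMLn → Set
  DMInc (i , a) (j , b) =
    (i ≡ j × SymInc (embPt i a) (embLn j b))
    ⊎ (i ≡ sucG G j × embPt i a ≡ embLn j b)

  dualMult : IncStr
  dualMult = incStr DMPt DMLn DMInc

  inM : Carrier G → DMPt → Set
  inM i p = proj₁ p ≡ i

  inL : Carrier G → DMLn → Set
  inL i l = proj₁ l ≡ i

-- A point of the i-th layer is incident with a line either inside the layer,
-- through the (symmetrised) incidence of 𝔐₀, or vertically, when both carry the
-- same element of S₀ ⊎ L₀. Within one layer points and lines sit in opposite
-- summands, so only the first kind occurs and the layer is 𝔐₀ or its dual
-- according to parity. Vertical incidences are injective in the point and in
-- the line, so two points (lines) of a layer can share a line (point) outside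
-- it only when they coincide; this gives closedness. Neither argument uses the
-- partial-linear-space axioms.
module Submission where

open import Defs
open import Data.Bool using (true; false; if_then_else_)
open import Data.Empty using (⊥-elim)
open import Data.Product using (Σ; _×_; _,_; proj₁)
open import Data.Sum using (inj₁; inj₂)
open import Function.Bundles using (_↔_; mk↔ₛ′; mk⇔)
open import Function.Construct.Composition using (_⇔-∘_)
open import Function.Construct.Identity using (⇔-id)
open import Function.Definitions using (Injective)
open import Function.Properties.Inverse using (↔-refl; ↔-trans)
open import Relation.Binary.PropositionalEquality using (_≡_; _≢_; refl; sym; trans; cong)

≅-trans : ∀ {𝔄 𝔅 ℭ} → 𝔄 ≅ 𝔅 → 𝔅 ≅ ℭ → 𝔄 ≅ ℭ
≅-trans f g = record
  { onPt      = ↔-trans (onPt f) (onPt g)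
  ; onLn      = ↔-trans (onLn f) (onLn g)
  ; preserves = λ p l → preserves g _ _ ⇔-∘ preserves f p l
  }
  where open _≅_

Σ-fibre↔ : ∀ {I : Set} (P : I → Set) (i : I) → Σ (Σ I P) (λ x → proj₁ x ≡ i) ↔ P i
Σ-fibre↔ P i = mk↔ₛ′ (λ { ((_ , a) , refl) → a }) (λ a → (i , a) , refl)
                     (λ _ → refl) (λ { ((_ , _) , refl) → refl })

module _ (𝔐₀ : IncStr) (G : IdxGroup) where

  layer : Carrier G → IncStr
  layer i = incStr (PtComp 𝔐₀ G i) (LnComp 𝔐₀ G i)
                   (λ a b → SymInc 𝔐₀ G (embPt 𝔐₀ G i a) (embLn 𝔐₀ G i b))

  embPt-injective : ∀ i → Injective _≡_ _≡_ (embPt 𝔐₀ G i)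
  embPt-injective i with isEvenG G i
  ... | true  = λ { refl → refl }
  ... | false = λ { refl → refl }

  embLn-injective : ∀ i → Injective _≡_ _≡_ (embLn 𝔐₀ G i)
  embLn-injective i with isEvenG G i
  ... | true  = λ { refl → refl }
  ... | false = λ { refl → refl }

  embPt≢embLn : ∀ i a b → embPt 𝔐₀ G i a ≢ embLn 𝔐₀ G i b
  embPt≢embLn i with isEvenG G i
  ... | true  = λ _ _ ()
  ... | false = λ _ _ ()

  layer-closed : ∀ i → IsClosed (dualMult 𝔐₀ G) (inM 𝔐₀ G i) (inL 𝔐₀ G i)
  layer-closed i = joining-line-in-layer , meeting-point-in-layer
    where
    joining-line-in-layer : ∀ p q l → p ≢ q → inM 𝔐₀ G i p → inM 𝔐₀ G i q →
                            DMInc 𝔐₀ G p l → DMInc 𝔐₀ G q l → inL 𝔐₀ G i l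
    joining-line-in-layer _ _ _ _ refl refl (inj₁ (j≡k , _)) _ = sym j≡k
    joining-line-in-layer _ _ _ _ refl refl (inj₂ _) (inj₁ (j≡k , _)) = sym j≡k
    joining-line-in-layer (_ , a) (_ , a′) _ p≢q refl refl (inj₂ (_ , a∼l)) (inj₂ (_ , a′∼l)) =
      ⊥-elim (p≢q (cong (i ,_) (embPt-injective i (trans a∼l (sym a′∼l)))))

    meeting-point-in-layer : ∀ l m p → l ≢ m → inL 𝔐₀ G i l → inL 𝔐₀ G i m →
                             DMInc 𝔐₀ G p l → DMInc 𝔐₀ G p m → inM 𝔐₀ G i p
    meeting-point-in-layer _ _ _ _ refl refl (inj₁ (k≡j , _)) _ = k≡j
    meeting-point-in-layer _ _ _ _ refl refl (inj₂ _) (inj₁ (k≡j , _)) = k≡j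
    meeting-point-in-layer (_ , b) (_ , b′) _ l≢m refl refl (inj₂ (_ , p∼b)) (inj₂ (_ , p∼b′)) =
      ⊥-elim (l≢m (cong (i ,_) (embLn-injective i (trans (sym p∼b) p∼b′))))

  sub≅layer : ∀ i → sub (dualMult 𝔐₀ G) (inM 𝔐₀ G i) (inL 𝔐₀ G i) ≅ layer i
  sub≅layer i = record
    { onPt      = Σ-fibre↔ (PtComp 𝔐₀ G) i
    ; onLn      = Σ-fibre↔ (LnComp 𝔐₀ G) i
    ; preserves = λ { ((_ , a) , refl) ((_ , b) , refl) →
        mk⇔ (λ { (inj₁ (_ , a∼b)) → a∼b ; (inj₂ (_ , a≡b)) → ⊥-elim (embPt≢embLn i a b a≡b) })
            (λ a∼b → inj₁ (refl , a∼b)) }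
    }

  layer≅ : ∀ i → layer i ≅ (if isEvenG G i then 𝔐₀ else dual 𝔐₀)
  layer≅ i with isEvenG G i
  ... | true  = record { onPt = ↔-refl ; onLn = ↔-refl ; preserves = λ _ _ → ⇔-id _ }
  ... | false = record { onPt = ↔-refl ; onLn = ↔-refl ; preserves = λ _ _ → ⇔-id _ }

fact2p6 : (𝔐₀ : IncStr) → IsPLS 𝔐₀ → (G : IdxGroup) → (i : Carrier G) →
          IsClosed (dualMult 𝔐₀ G) (inM 𝔐₀ G i) (inL 𝔐₀ G i)
          × (sub (dualMult 𝔐₀ G) (inM 𝔐₀ G i) (inL 𝔐₀ G i)
               ≅ (if isEvenG G i then 𝔐₀ else dual 𝔐₀))
fact2p6 𝔐₀ _ G i = layer-closed 𝔐₀ G i , ≅-trans (sub≅layer 𝔐₀ G i) (layer≅ 𝔐₀ G i)
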